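{- The logic $\mathsf{CnCK}$ is non-trivial and negation-inconsistent. Moreover, $\to$ is fully hyperconnexive in $\mathsf{CnCK}$, and $\Rightarrow$ is fully connexive in $\mathsf{CnCK}$ but neither plainly nor weakly hyperconnexive in $\mathsf{CnCK}$.
   Context: Conditional formulas are built from propositional letters with $\wedge,\vee,\to$, $\sim$ (strong negation), binary $\mathbin{\Box\!\!\to}$, $\mathbin{\Diamond\!\!\to}$; $\phi\Rightarrow\psi:=(\phi\to\psi)\wedge(\sim\psi\to\sim\phi)$. A conditional Fischer-Servi model is $(W,\leq,R,V^+,V^-)$, $W\neq\emptyset$, $\leq$ a preorder, $R\subseteq W\times(\mathcal{P}(W))^2\times W$, $V^\pm$ maps letters to $\leq$-upward closed sets, such that for all $X,Y$, $R_{(X,Y)}=\{(w,v)\mid R(w,(X,Y),v)\}$ satisfies (c1) $w\leq w'$, $wR_{(X,Y)}v$ imply $w'R_{(X,Y)}v'$, $v\leq v'$ for some $v'$; (c2) $wR_{(X,Y)}v$, $v\leq v'$ imply $w\leq w'$, $w'R_{(X,Y)}v'$ for some $w'$. Satisfaction: $w\models^\pm p$ iff $w\in V^\pm(p)$; $\wedge$: $+$ iff both $+$, $-$ iff some $-$; $\vee$: $+$ iff some $+$, $-$ iff both $-$; $w\models^\pm\sim\psi$ iff $w\models^\mp\psi$; $w\models^+\psi\to\chi$ iff $\forall v\geq w(v\models^+\psi\Rightarrow v\models^+\chi)$; $w\models^-\psi\to\chi$ iff $\forall v\geq w(v\models^+\psi\Rightarrow v\models^-\chi)$; with $\|\psi\|=(\{w\mid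 w\models^+\psi\},\{w\mid w\models^-\psi\})$: $w\models^\pm\psi\mathbin{\Box\!\!\to}\chi$ iff $\forall v\geq w\,\forall u(vR_{\|\psi\|}u\Rightarrow u\models^\pm\chi)$; $w\models^\pm\psi\mathbin{\Diamond\!\!\to}\chi$ iff $\exists u(wR_{\|\psi\|}u$ and $u\models^\pm\chi)$. $\Gamma\models_{\mathsf{CnCK}}\Delta$ iff no world verifies all of $\Gamma$ and none of $\Delta$; $\phi\in\mathsf{CnCK}$ iff $\emptyset\models\{\phi\}$. For a logic $\mathsf{L}$: trivial iff $\Gamma\models_\mathsf{L}\Delta$ for all $\Gamma,\Delta$; negation-inconsistent iff $\phi\wedge\sim\phi\in\mathsf{L}$ for some $\phi$. For a binary $\ast$, schemes: (AT) $\sim(\sim\phi\ast\phi)$; (BT) $(\phi\ast\sim\psi)\ast\sim(\phi\ast\psi)$; (nonSym) $(\phi\ast\psi)\ast(\psi\ast\phi)$; (WBT) $\phi\ast\sim\psi\models_\mathsf{L}\sim(\phi\ast\psi)$; (WnonSym) $\phi\ast\psi\models_\mathsf{L}\psi\ast\phi$; (CBT) $\sim(\phi\ast\psi)\ast(\phi\ast\sim\psi)$; (WCBT) $\sim(\phi\ast\psi)\models_\mathsf{L}\phi\ast\sim\psi$. Plainly connexive: all AT, BT instances valid, some nonSym instance not; weakly connexive: all AT, WBT hold, some WnonSym fails; fully connexive: both. Plainly (weakly) hyperconnexive: plainly (weakly) connexive plus all CBT (WCBT); fully hyperconnexive: both. -}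

module Defs where

open import Level using (Level; _⊔_) renaming (suc to lsuc; zero to lzero)
open import Data.Nat using (ℕ)
open import Data.Product using (Σ; ∃; _×_; _,_)
open import Data.Sum using (_⊎_)
open import Relation.Nullary using (¬_)
open import Relation.Binary.PropositionalEquality using (_≡_)

infixr 6 _∧ᶠ_
infixr 5 _∨ᶠ_
infixr 4 _⇾_ _□→_ _◇→_ _⇒_
infix 30 ∼_

data Fm : Set where
  var   : ℕ → Fm
  _∧ᶠ_  : Fm → Fm → Fm
  _∨ᶠ_  : Fm → Fm → Fm
  _⇾_   : Fm → Fm → Fm          -- intuitionistic implication  →
  ∼_    : Fm → Fm
  _□→_  : Fm → Fm → Fm
  _◇→_  : Fm → Fm → Fm

_⇒_ : Fm → Fm → Fm
φ ⇒ ψ = (φ ⇾ ψ) ∧ᶠ (∼ ψ ⇾ ∼ φ)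

Subset : Set → Set₁
Subset W = W → Set

_≐_ : {W : Set} → Subset W → Subset W → Set
X ≐ Y = ∀ w → (X w → Y w) × (Y w → X w)

record Model : Set₁ where
  field
    W      : Set
    inhab  : W
    _≤_    : W → W → Set
    ≤-refl  : ∀ {w} → w ≤ w
    ≤-trans : ∀ {u v w} → u ≤ v → v ≤ w → u ≤ w
    -- R ⊆ W × (P(W))² × W, written R w X Y v for R(w,(X,Y),v)
    R      : W → Subset W → Subset W → W → Set
    -- R depends only on the sets X, Y (not on how they are presented)
    R-ext  : ∀ {X X' Y Y' w v} → X ≐ X' → Y ≐ Y' → R w X Y v → R w X' Y' v
    V⁺     : ℕ → Subset W
    V⁻     : ℕ → Subset W
    V⁺-up  : ∀ {p w w'} → w ≤ w' → V⁺ p w → V⁺ p w'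
    V⁻-up  : ∀ {p w w'} → w ≤ w' → V⁻ p w → V⁻ p w'
    c1     : ∀ {X Y w w' v} → w ≤ w' → R w X Y v →
             Σ W (λ v' → R w' X Y v' × v ≤ v')
    c2     : ∀ {X Y w v v'} → R w X Y v → v ≤ v' →
             Σ W (λ w' → w ≤ w' × R w' X Y v')

data Sign : Set where
  pos neg : Sign

flip : Sign → Sign
flip pos = neg
flip neg = pos

module _ (M : Model) where
  open Model M

  -- sat s w φ : w ⊨^s φ  (s = pos for ⊨⁺, neg for ⊨⁻)
  sat : Sign → W → Fm → Set
  sat pos w (var p)   = V⁺ p w
  sat neg w (var p)   = V⁻ p w
  sat pos w (φ ∧ᶠ ψ)  = sat pos w φ × sat pos w ψ
  sat neg w (φ ∧ᶠ ψ)  = sat neg w φ ⊎ sat neg w ψ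
  sat pos w (φ ∨ᶠ ψ)  = sat pos w φ ⊎ sat pos w ψ
  sat neg w (φ ∨ᶠ ψ)  = sat neg w φ × sat neg w ψ
  sat s   w (∼ φ)     = sat (flip s) w φ
  sat pos w (φ ⇾ ψ)   = ∀ v → w ≤ v → sat pos v φ → sat pos v ψ
  sat neg w (φ ⇾ ψ)   = ∀ v → w ≤ v → sat pos v φ → sat neg v ψ
  sat s   w (φ □→ ψ)  = ∀ v → w ≤ v → ∀ u →
                          R v (λ x → sat pos x φ) (λ x → sat neg x φ) u →
                          sat s u ψ
  sat s   w (φ ◇→ ψ)  = Σ W (λ u → R w (λ x → sat pos x φ) (λ x → sat neg x φ) u
                                    × sat s u ψ)

FmSet : Set₁
FmSet = Fm → Set

∅ : FmSet
∅ _ = Data.Empty.⊥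
  where import Data.Empty

⟦_⟧ : Fm → FmSet
⟦ φ ⟧ ψ = ψ ≡ φ

Logic : Set₂
Logic = FmSet → FmSet → Set₁

_⊨CnCK_ : Logic
Γ ⊨CnCK Δ = (M : Model) → (w : Model.W M) →
  ¬ ((∀ φ → Γ φ → sat M pos w φ) × (∀ ψ → Δ ψ → ¬ sat M pos w ψ))

module _ (⊨ : Logic) where

  _∈L : Fm → Set₁
  φ ∈L = ⊨ ∅ ⟦ φ ⟧

  Trivial : Set₁
  Trivial = ∀ Γ Δ → ⊨ Γ Δ

  NegInconsistent : Set₁
  NegInconsistent = Σ Fm (λ φ → (φ ∧ᶠ ∼ φ) ∈L)

  module _ (_∗_ : Fm → Fm → Fm) where

    AT : Set₁
    AT = ∀ φ → (∼ ((∼ φ) ∗ φ)) ∈L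

    BT : Set₁
    BT = ∀ φ ψ → ((φ ∗ (∼ ψ)) ∗ (∼ (φ ∗ ψ))) ∈L

    NotNonSym : Set₁
    NotNonSym = Σ Fm (λ φ → Σ Fm (λ ψ → ¬ (((φ ∗ ψ) ∗ (ψ ∗ φ)) ∈L)))

    WBT : Set₁
    WBT = ∀ φ ψ → ⊨ ⟦ φ ∗ (∼ ψ) ⟧ ⟦ ∼ (φ ∗ ψ) ⟧

    NotWNonSym : Set₁
    NotWNonSym = Σ Fm (λ φ → Σ Fm (λ ψ → ¬ ⊨ ⟦ φ ∗ ψ ⟧ ⟦ ψ ∗ φ ⟧))

    CBT : Set₁
    CBT = ∀ φ ψ → ((∼ (φ ∗ ψ)) ∗ (φ ∗ (∼ ψ))) ∈L

    WCBT : Set₁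
    WCBT = ∀ φ ψ → ⊨ ⟦ ∼ (φ ∗ ψ) ⟧ ⟦ φ ∗ (∼ ψ) ⟧

    PlainlyConnexive : Set₁
    PlainlyConnexive = AT × BT × NotNonSym

    WeaklyConnexive : Set₁
    WeaklyConnexive = AT × WBT × NotWNonSym

    FullyConnexive : Set₁
    FullyConnexive = PlainlyConnexive × WeaklyConnexive

    PlainlyHyperconnexive : Set₁
    PlainlyHyperconnexive = PlainlyConnexive × CBT

    WeaklyHyperconnexive : Set₁
    WeaklyHyperconnexive = WeaklyConnexive × WCBT

    FullyHyperconnexive : Set₁
    FullyHyperconnexive = PlainlyHyperconnexive × WeaklyHyperconnexive

{-# OPTIONS --safe #-}
module Submission where

open import Defs
open import Data.Product using (_×_; _,_; proj₁; proj₂)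
open import Data.Sum using (inj₁)
open import Data.Unit using (⊤; tt)
open import Data.Empty using (⊥)
open import Data.Nat using (ℕ)
open import Function using (id; _∘_)
open import Relation.Nullary using (¬_)
open import Relation.Binary.PropositionalEquality using (_≡_; refl)

-- The falsity condition of φ → ψ is literally the truth condition of φ → ∼ψ,
-- so ∼(φ → ψ) and φ → ∼ψ are interchangeable; this gives all the Aristotle-
-- and Boethius-type theses for →, and for ⇒, whose falsity is the falsity of
-- either conjunct. In particular (p ∧ ∼p) → p is both true and false
-- everywhere. Every failure is witnessed by one world where q is true and no
-- letter is false: there p → q and ∼(p ⇒ q) hold vacuously, while q → p fails
-- and so does p ⇒ ∼q, which would need q to make p false.

record Valid (φ : Fm) : Set₁ where
  constructor valid
  field holds : ∀ M w → sat M pos w φ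

infix 2 _⊨ₗ_

record _⊨ₗ_ (φ ψ : Fm) : Set₁ where
  constructor entails
  field transfer : ∀ M w → sat M pos w φ → sat M pos w ψ

open Valid
open _⊨ₗ_

_∈CnCK : Fm → Set₁
φ ∈CnCK = _∈L _⊨CnCK_ φ

Valid⇒∈CnCK : ∀ {φ} → Valid φ → φ ∈CnCK
Valid⇒∈CnCK {φ} ⊨φ M w (_ , ⊭φ) = ⊭φ φ refl (holds ⊨φ M w)

⊨ₗ⇒⊨CnCK : ∀ {φ ψ} → φ ⊨ₗ ψ → ⟦ φ ⟧ ⊨CnCK ⟦ ψ ⟧
⊨ₗ⇒⊨CnCK {φ} {ψ} φ⊨ψ M w (⊨Γ , ⊭ψ) = ⊭ψ ψ refl (transfer φ⊨ψ M w (⊨Γ φ refl))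

Valid-⊨ₗ : ∀ {φ ψ} → Valid φ → φ ⊨ₗ ψ → Valid ψ
Valid-⊨ₗ ⊨φ φ⊨ψ = valid λ M w → transfer φ⊨ψ M w (holds ⊨φ M w)

⊨ₗ-refl : ∀ {φ} → φ ⊨ₗ φ
⊨ₗ-refl = entails λ _ _ → id

⊨ₗ-trans : ∀ {φ ψ χ} → φ ⊨ₗ ψ → ψ ⊨ₗ χ → φ ⊨ₗ χ
⊨ₗ-trans φ⊨ψ ψ⊨χ = entails λ M w → transfer ψ⊨χ M w ∘ transfer φ⊨ψ M w

∧-Valid : ∀ {φ ψ} → Valid φ → Valid ψ → Valid (φ ∧ᶠ ψ)
∧-Valid ⊨φ ⊨ψ = valid λ M w → holds ⊨φ M w , holds ⊨ψ M w

∧-⊨ₗˡ : ∀ {φ ψ} → φ ∧ᶠ ψ ⊨ₗ φ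
∧-⊨ₗˡ = entails λ _ _ → proj₁

∧-⊨ₗʳ : ∀ {φ ψ} → φ ∧ᶠ ψ ⊨ₗ ψ
∧-⊨ₗʳ = entails λ _ _ → proj₂

∼∼-⊨ₗ : ∀ {φ} → ∼ ∼ φ ⊨ₗ φ
∼∼-⊨ₗ = entails λ _ _ → id

⇾-Valid : ∀ {φ ψ} → φ ⊨ₗ ψ → Valid (φ ⇾ ψ)
⇾-Valid φ⊨ψ = valid λ M w v _ → transfer φ⊨ψ M v

⇒-Valid : ∀ {φ ψ} → φ ⊨ₗ ψ → ∼ ψ ⊨ₗ ∼ φ → Valid (φ ⇒ ψ)
⇒-Valid φ⊨ψ ∼ψ⊨∼φ = ∧-Valid (⇾-Valid φ⊨ψ) (⇾-Valid ∼ψ⊨∼φ)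

⇾∼-⊨ₗ-∼⇾ : ∀ {φ ψ} → φ ⇾ ∼ ψ ⊨ₗ ∼ (φ ⇾ ψ)
⇾∼-⊨ₗ-∼⇾ = entails λ _ _ → id

∼⇾-⊨ₗ-⇾∼ : ∀ {φ ψ} → ∼ (φ ⇾ ψ) ⊨ₗ φ ⇾ ∼ ψ
∼⇾-⊨ₗ-⇾∼ = entails λ _ _ → id

⇒∼-⊨ₗ-∼⇒ : ∀ {φ ψ} → φ ⇒ ∼ ψ ⊨ₗ ∼ (φ ⇒ ψ)
⇒∼-⊨ₗ-∼⇒ = entails λ _ _ φ⇒∼ψ → inj₁ (proj₁ φ⇒∼ψ)

⇒-⊨ₗ-∼⇒∼ : ∀ {φ ψ} → φ ⇒ ψ ⊨ₗ ∼ (φ ⇒ ∼ ψ)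
⇒-⊨ₗ-∼⇒∼ = entails λ _ _ φ⇒ψ → inj₁ (proj₁ φ⇒ψ)

module Refutation (M : Model) (w : Model.W M) where

  open Model M using (≤-refl)

  refute-∈CnCK : ∀ {φ} → ¬ sat M pos w φ → ¬ φ ∈CnCK
  refute-∈CnCK ⊭φ φ∈ = φ∈ M w ((λ _ ()) , λ { _ refl → ⊭φ })

  refute-⊨CnCK : ∀ {φ ψ} → sat M pos w φ → ¬ sat M pos w ψ → ¬ ⟦ φ ⟧ ⊨CnCK ⟦ ψ ⟧
  refute-⊨CnCK ⊨φ ⊭ψ φ⊨ψ = φ⊨ψ M w ((λ { _ refl → ⊨φ }) , λ { _ refl → ⊭ψ })

  ⇾-refute : ∀ φ ψ → sat M pos w φ → ¬ sat M pos w ψ → ¬ sat M pos w (φ ⇾ ψ)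
  ⇾-refute _ _ ⊨φ ⊭ψ ⊨φ⇾ψ = ⊭ψ (⊨φ⇾ψ w ≤-refl ⊨φ)

  ⇒-refute : ∀ φ ψ → sat M pos w φ → ¬ sat M pos w ψ → ¬ sat M pos w (φ ⇒ ψ)
  ⇒-refute φ ψ ⊨φ ⊭ψ ⊨φ⇒ψ = ⇾-refute φ ψ ⊨φ ⊭ψ (proj₁ ⊨φ⇒ψ)

pointModel : (ℕ → Set) → (ℕ → Set) → Model
pointModel P N = record
  { W = ⊤ ; inhab = tt ; _≤_ = λ _ _ → ⊤ ; ≤-refl = tt ; ≤-trans = λ _ _ → tt
  ; R = λ _ _ _ _ → ⊥ ; R-ext = λ _ _ → id
  ; V⁺ = λ n _ → P n ; V⁻ = λ n _ → N n
  ; V⁺-up = λ _ → id ; V⁻-up = λ _ → id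
  ; c1 = λ _ () ; c2 = λ () }

p q : Fm
p = var 0
q = var 1

onlyQ : Model
onlyQ = pointModel (_≡ 1) (λ _ → ⊥)

open Refutation onlyQ tt

⊨p⇾ : ∀ φ → sat onlyQ pos tt (p ⇾ φ)
⊨p⇾ _ _ _ ()

⊭p : ¬ sat onlyQ pos tt p
⊭p ()

⊨p⇒q : sat onlyQ pos tt (p ⇒ q)
⊨p⇒q = ⊨p⇾ q , λ _ _ ()

⊨∼[p⇒q] : sat onlyQ pos tt (∼ (p ⇒ q))
⊨∼[p⇒q] = inj₁ (⊨p⇾ (∼ q))

⊭p⇒∼q : ¬ sat onlyQ pos tt (p ⇒ ∼ q)
⊭p⇒∼q = ⇾-refute (∼ ∼ q) (∼ p) refl (λ ()) ∘ proj₂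

¬Trivial : ¬ Trivial _⊨CnCK_
¬Trivial trivial = refute-∈CnCK ⊭p (trivial ∅ ⟦ p ⟧)

negInconsistent : NegInconsistent _⊨CnCK_
negInconsistent =
  ((p ∧ᶠ ∼ p) ⇾ p) ,
  Valid⇒∈CnCK (∧-Valid (⇾-Valid ∧-⊨ₗˡ) (Valid-⊨ₗ (⇾-Valid ∧-⊨ₗʳ) ⇾∼-⊨ₗ-∼⇾))

⇾-AT : AT _⊨CnCK_ _⇾_
⇾-AT φ = Valid⇒∈CnCK (Valid-⊨ₗ (⇾-Valid ⊨ₗ-refl) ⇾∼-⊨ₗ-∼⇾)

⇾-BT : BT _⊨CnCK_ _⇾_
⇾-BT φ ψ = Valid⇒∈CnCK (⇾-Valid ⇾∼-⊨ₗ-∼⇾)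

⇾-CBT : CBT _⊨CnCK_ _⇾_
⇾-CBT φ ψ = Valid⇒∈CnCK (⇾-Valid ∼⇾-⊨ₗ-⇾∼)

⇾-WBT : WBT _⊨CnCK_ _⇾_
⇾-WBT φ ψ = ⊨ₗ⇒⊨CnCK ⇾∼-⊨ₗ-∼⇾

⇾-WCBT : WCBT _⊨CnCK_ _⇾_
⇾-WCBT φ ψ = ⊨ₗ⇒⊨CnCK ∼⇾-⊨ₗ-⇾∼

⇾-NotNonSym : NotNonSym _⊨CnCK_ _⇾_
⇾-NotNonSym =
  p , q , refute-∈CnCK (⇾-refute (p ⇾ q) (q ⇾ p) (⊨p⇾ q) (⇾-refute q p refl ⊭p))

⇾-NotWNonSym : NotWNonSym _⊨CnCK_ _⇾_
⇾-NotWNonSym = p , q , refute-⊨CnCK (⊨p⇾ q) (⇾-refute q p refl ⊭p)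

⇒-AT : AT _⊨CnCK_ _⇒_
⇒-AT φ = Valid⇒∈CnCK (Valid-⊨ₗ (⇒-Valid ⊨ₗ-refl ⊨ₗ-refl) ⇒∼-⊨ₗ-∼⇒)

⇒-BT : BT _⊨CnCK_ _⇒_
⇒-BT φ ψ = Valid⇒∈CnCK (⇒-Valid ⇒∼-⊨ₗ-∼⇒ (⊨ₗ-trans ∼∼-⊨ₗ ⇒-⊨ₗ-∼⇒∼))

⇒-WBT : WBT _⊨CnCK_ _⇒_
⇒-WBT φ ψ = ⊨ₗ⇒⊨CnCK ⇒∼-⊨ₗ-∼⇒

⇒-NotNonSym : NotNonSym _⊨CnCK_ _⇒_
⇒-NotNonSym =
  p , q , refute-∈CnCK (⇒-refute (p ⇒ q) (q ⇒ p) ⊨p⇒q (⇒-refute q p refl ⊭p))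

⇒-NotWNonSym : NotWNonSym _⊨CnCK_ _⇒_
⇒-NotWNonSym = p , q , refute-⊨CnCK ⊨p⇒q (⇒-refute q p refl ⊭p)

⇒-¬CBT : ¬ CBT _⊨CnCK_ _⇒_
⇒-¬CBT cbt =
  refute-∈CnCK (⇒-refute (∼ (p ⇒ q)) (p ⇒ ∼ q) ⊨∼[p⇒q] ⊭p⇒∼q) (cbt p q)

⇒-¬WCBT : ¬ WCBT _⊨CnCK_ _⇒_
⇒-¬WCBT wcbt = refute-⊨CnCK ⊨∼[p⇒q] ⊭p⇒∼q (wcbt p q)

corollary5p18 : ¬ Trivial _⊨CnCK_
                × NegInconsistent _⊨CnCK_
                × FullyHyperconnexive _⊨CnCK_ _⇾_
                × FullyConnexive _⊨CnCK_ _⇒_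
                × ¬ PlainlyHyperconnexive _⊨CnCK_ _⇒_
                × ¬ WeaklyHyperconnexive _⊨CnCK_ _⇒_
corollary5p18 =
  ¬Trivial , negInconsistent
  , ( ((⇾-AT , ⇾-BT , ⇾-NotNonSym) , ⇾-CBT)
    , ((⇾-AT , ⇾-WBT , ⇾-NotWNonSym) , ⇾-WCBT))
  , ((⇒-AT , ⇒-BT , ⇒-NotNonSym) , (⇒-AT , ⇒-WBT , ⇒-NotWNonSym))
  , (λ plainly → ⇒-¬CBT (proj₂ plainly))
  , (λ weakly → ⇒-¬WCBT (proj₂ weakly))
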